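{- Let $D_n=\langle a,b\mid a^n=b^2=1,\ bab=a^{ -1}\rangle$, let $H\subseteq D_n$ be a connecting set, and let $\Gamma={\rm Cay}(D_n,H)$ with vertex set $V=V'\cup V''$ where $V'=\langle a\rangle$ and $V''=D_n\setminus V'$. Let $v\in V'$ and let $T$ be the set of neighbours of $v$ in $\Gamma$. If $|T\cap V'|=|T\cap V''|$, then $\Gamma$ is singular.
   Context: A subset $H$ of a finite group $G$ is a connecting set if $H^{ -1}=H$, $1_G\notin H$, and $H$ generates $G$. The Cayley graph ${\rm Cay}(G,H)$ has vertex set $G$, with distinct $u,v$ adjacent iff $vu^{ -1}\in H$. A graph is singular if its adjacency matrix is singular. -}

module Defs where

open import Data.Nat using (ℕ; zero; suc; _+_; _∸_; NonZero)
open import Data.Nat.DivMod using (_mod_)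
open import Data.Fin using (Fin; toℕ; splitAt; punchIn) renaming (zero to fzero; suc to fsuc)
open import Data.Fin.Properties using () renaming (_≟_ to _≟F_)
open import Data.Bool using (Bool; true; false; _xor_; _∧_; not; if_then_else_)
open import Data.Bool.Properties using () renaming (_≟_ to _≟B_)
open import Data.Product using (_×_; _,_; proj₁; proj₂)
open import Data.Product.Properties using (≡-dec)
open import Data.Sum using (inj₁; inj₂)
open import Data.List using (List; []; _∷_; foldr)
open import Data.List.Relation.Unary.All using (All)
open import Data.Integer using (ℤ; +_; -_) renaming (_+_ to _+ℤ_; _*_ to _*ℤ_)
open import Relation.Nullary.Decidable using (⌊_⌋)
open import Relation.Binary.PropositionalEquality using (_≡_)
open import Relation.Binary.Definitions using (DecidableEquality)

-- The dihedral group D_n = ⟨ a, b | a^n = b^2 = 1, bab = a⁻¹ ⟩ (n ≥ 1),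
-- of order 2n, realised concretely: the pair (i , s) stands for the
-- element a^i b^s  (i ∈ ℤ/n, s ∈ {0,1}, with true = 1).

module Dihedral (n : ℕ) {{_ : NonZero n}} where

  D : Set
  D = Fin n × Bool

  _≟D_ : DecidableEquality D
  _≟D_ = ≡-dec _≟F_ _≟B_

  _⊕_ : Fin n → Fin n → Fin n
  i ⊕ j = (toℕ i + toℕ j) mod n

  ⊖_ : Fin n → Fin n
  ⊖ j = (n ∸ toℕ j) mod n

  -- (a^i b^s)(a^j b^t) = a^(i + (-1)^s j) b^(s+t), using b a^j = a^(-j) b
  _·_ : D → D → D
  (i , false) · (j , t) = (i ⊕ j , t)
  (i , true)  · (j , t) = (i ⊕ (⊖ j) , not t)

  one : D
  one = (0 mod n , false)

  a : D
  a = (1 mod n , false)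

  b : D
  b = (0 mod n , true)

  _⁻¹ : D → D
  (i , false) ⁻¹ = (⊖ i , false)
  (i , true)  ⁻¹ = (i , true)

  inV' : D → Bool
  inV' (_ , s) = not s

  prod : List D → D
  prod = foldr _·_ one

  Subset : Set
  Subset = D → Bool

  _∈_ : D → Subset → Set
  g ∈ H = H g ≡ true

  InHorInv : Subset → D → Set
  InHorInv H g = H g ≡ true Data.Sum.⊎ H (g ⁻¹) ≡ true

  Generates : Subset → Set
  Generates H = ∀ (g : D) → Data.Product.Σ (List D) λ ws →
                  All (InHorInv H) ws × prod ws ≡ g

  record IsConnectingSet (H : Subset) : Set where
    field
      symmetric : ∀ g → H (g ⁻¹) ≡ H g
      no-one    : H one ≡ false
      generates : Generates H

  adj : Subset → D → D → Bool
  adj H u v = not ⌊ u ≟D v ⌋ ∧ H (v · (u ⁻¹))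

  enum : Fin (n + n) → D
  enum k with splitAt n k
  ... | inj₁ i = (i , false)
  ... | inj₂ i = (i , true)

  adjMatrix : Subset → Fin (n + n) → Fin (n + n) → ℤ
  adjMatrix H k l = if adj H (enum k) (enum l) then + 1 else + 0

countFin : ∀ {m} → (Fin m → Bool) → ℕ
countFin {zero}  p = 0
countFin {suc m} p = (if p fzero then 1 else 0) + countFin (λ i → p (fsuc i))

sumℤ : ∀ {m} → (Fin m → ℤ) → ℤ
sumℤ {zero}  f = + 0
sumℤ {suc m} f = f fzero +ℤ sumℤ (λ i → f (fsuc i))

signℤ : ℕ → ℤ
signℤ zero          = + 1
signℤ (suc zero)    = - (+ 1)
signℤ (suc (suc k)) = signℤ k

det : ∀ m → (Fin m → Fin m → ℤ) → ℤ
det zero    M = + 1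
det (suc m) M = sumℤ λ j →
  signℤ (toℕ j) *ℤ (M fzero j *ℤ det m (λ r c → M (fsuc r) (punchIn j c)))

Singular : ∀ m → (Fin m → Fin m → ℤ) → Set
Singular m M = det m M ≡ + 0

-- The rotations V′ = ⟨a⟩ and the reflections V″ are the cosets of ⟨a⟩, and u ~ v iff v · u⁻¹ ∈ H
-- (for u ≡ v this uses 1 ∉ H, the only property of a connecting set that is needed). As u runs
-- through a coset, so does v · u⁻¹; hence every vertex has |H ∩ V′| neighbours in one coset and
-- |H ∩ V″| in the other, for rows and columns alike. The hypothesis therefore says
-- |H ∩ V′| = |H ∩ V″|, and the vector that is 1 on V′ and -1 on V″ is a left null vector of the
-- adjacency matrix. The determinant, defined by Laplace expansion along the first row, is
-- alternating: swapping the first two rows negates it (expand along both rows at once), and every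
-- other transposition involving the first row is conjugate to that one by a transposition of lower
-- rows. By linearity in the first row, a row dependency with a nonzero coefficient then forces the
-- determinant to vanish.

module Submission where

open import Defs
open import Data.Nat.Base using (ℕ; NonZero)
open import Data.Bool.Base using (false)
open import Relation.Binary.PropositionalEquality using (_≡_)

module FinSum where
  open import Data.Nat.Base as ℕ using (ℕ; zero; suc)
  open import Data.Fin.Base using (Fin; zero; suc; _↑ˡ_; _↑ʳ_)
  open import Data.Fin.Permutation using (permutation)
  open import Data.Bool.Base using (Bool; true; false; if_then_else_)
  open import Data.Integer.Base using (ℤ; +_; -_; _+_; _*_; -1ℤ)
  open import Data.Integer.Properties using (+-*-semiring; +-identityˡ; +-assoc; -1*i≡-i)
  open import Algebra.Properties.Semiring.Sum +-*-semiring
    using (sum; sum-cong-≗; sum-permute; *-distribˡ-sum)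
  open import Function.Base using (_∘_)
  open import Relation.Binary.PropositionalEquality
  open ≡-Reasoning

  sumℤ≡sum : ∀ {m} (f : Fin m → ℤ) → sumℤ f ≡ sum f
  sumℤ≡sum {zero}  f = refl
  sumℤ≡sum {suc m} f = cong (λ s → f zero + s) (sumℤ≡sum (f ∘ suc))

  sum-neg : ∀ {m} (f : Fin m → ℤ) → sum (λ i → - f i) ≡ - sum f
  sum-neg f = begin
    sum (λ i → - f i)      ≡⟨ sum-cong-≗ (λ i → sym (-1*i≡-i (f i))) ⟩
    sum (λ i → -1ℤ * f i)  ≡⟨ *-distribˡ-sum -1ℤ f ⟨
    -1ℤ * sum f            ≡⟨ -1*i≡-i (sum f) ⟩
    - sum f                ∎

  sum-↑ : ∀ a {b} (f : Fin (a ℕ.+ b) → ℤ) → sum f ≡ sum (f ∘ (_↑ˡ b)) + sum (f ∘ (a ↑ʳ_))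
  sum-↑ zero    f = sym (+-identityˡ _)
  sum-↑ (suc a) f =
    trans (cong (λ s → f zero + s) (sum-↑ a (f ∘ suc))) (sym (+-assoc (f zero) _ _))

  sum-reindex : ∀ {m} (f : Fin m → ℤ) {π ρ : Fin m → Fin m} →
                (∀ i → π (ρ i) ≡ i) → (∀ i → ρ (π i) ≡ i) → sum (f ∘ π) ≡ sum f
  sum-reindex f πρ ρπ = sym (sum-permute f (permutation _ _ πρ ρπ))

  𝟙 : Bool → ℤ
  𝟙 b = if b then + 1 else + 0

  sum-𝟙 : ∀ {m} (p : Fin m → Bool) → sum (𝟙 ∘ p) ≡ + countFin p
  sum-𝟙 {zero}  p = refl
  sum-𝟙 {suc m} p with p zero
  ... | true  = cong (λ s → + 1 + s) (sum-𝟙 (p ∘ suc))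
  ... | false = trans (+-identityˡ _) (sum-𝟙 (p ∘ suc))

module Determinant where
  open FinSum using (sumℤ≡sum; sum-neg)
  open import Data.Nat.Base using (ℕ; zero; suc)
  open import Data.Fin.Base using (Fin; zero; suc; toℕ; punchIn)
  open import Data.Fin.Properties using (_≟_; punchInᵢ≢i)
  import Data.Fin.Permutation as Perm
  open import Data.Fin.Permutation.Components using (transpose)
  open import Data.Integer.Base using (ℤ; +_; -[1+_]; -_; _+_; _*_; 0ℤ)
  open import Data.Integer.Properties
    using (+-*-semiring; neg-involutive; *-zeroʳ; +-identityˡ; +-identityʳ; i*j≡0⇒i≡0∨j≡0)
  open import Algebra.Properties.Semiring.Sum +-*-semiring
    using (sum; sum-cong-≗; sum-remove; sum-replicate-zero; sum-permute; ∑-comm;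
           *-distribˡ-sum; *-distribʳ-sum)
  open import Data.Integer.Tactic.RingSolver using (solve-∀)
  open import Data.Empty using (⊥-elim)
  open import Data.Bool.Base using (if_then_else_)
  open import Data.Sum.Base using (fromInj₂)
  open import Function.Base using (_∘_)
  open import Relation.Nullary using (yes; no; does)
  open import Relation.Nullary.Decidable using (dec-true; dec-false)
  open import Relation.Binary.PropositionalEquality
  open ≡-Reasoning

  Matrix : ℕ → Set
  Matrix m = Fin m → Fin m → ℤ

  i≡-i⇒i≡0 : ∀ i → i ≡ - i → i ≡ 0ℤ
  i≡-i⇒i≡0 (+ zero)  _ = refl
  i≡-i⇒i≡0 (+ suc _) ()
  i≡-i⇒i≡0 -[1+ _ ] ()

  sgn : ∀ {m} → Fin m → ℤ
  sgn j = signℤ (toℕ j)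

  signℤ-suc : ∀ k → signℤ (suc k) ≡ - signℤ k
  signℤ-suc zero          = refl
  signℤ-suc (suc zero)    = refl
  signℤ-suc (suc (suc k)) = signℤ-suc k

  sgn-suc : ∀ {m} (j : Fin m) → sgn (suc j) ≡ - sgn j
  sgn-suc j = signℤ-suc (toℕ j)

  -- A total variant of punchOut; its value on the diagonal q ≡ p is junk.
  punchOut′ : ∀ {m} → Fin (suc (suc m)) → Fin (suc (suc m)) → Fin (suc m)
  punchOut′          zero    zero    = zero
  punchOut′          zero    (suc q) = q
  punchOut′          (suc p) zero    = zero
  punchOut′ {zero}   (suc p) (suc q) = zero
  punchOut′ {suc m}  (suc p) (suc q) = suc (punchOut′ p q)

  punchOut′-punchIn : ∀ {m} (p : Fin (suc (suc m))) k → punchOut′ p (punchIn p k) ≡ k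
  punchOut′-punchIn          zero    k       = refl
  punchOut′-punchIn          (suc p) zero    = refl
  punchOut′-punchIn {suc m}  (suc p) (suc k) = cong suc (punchOut′-punchIn p k)

  punchIn-punchOut′-comm : ∀ {m} {p q : Fin (suc (suc m))} → p ≢ q → ∀ c →
    punchIn p (punchIn (punchOut′ p q) c) ≡ punchIn q (punchIn (punchOut′ q p) c)
  punchIn-punchOut′-comm {p = zero}  {zero}  p≢q c = ⊥-elim (p≢q refl)
  punchIn-punchOut′-comm {p = zero}  {suc q} p≢q c = refl
  punchIn-punchOut′-comm {p = suc p} {zero}  p≢q c = refl
  punchIn-punchOut′-comm {zero}  {suc zero} {suc zero} p≢q c = ⊥-elim (p≢q refl)
  punchIn-punchOut′-comm {suc m} {suc p} {suc q} p≢q zero    = refl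
  punchIn-punchOut′-comm {suc m} {suc p} {suc q} p≢q (suc c) =
    cong suc (punchIn-punchOut′-comm (p≢q ∘ cong suc) c)

  sgn-punchOut′-anti : ∀ {m} {p q : Fin (suc (suc m))} → p ≢ q →
    sgn p * sgn (punchOut′ p q) ≡ - (sgn q * sgn (punchOut′ q p))
  sgn-punchOut′-anti {p = zero}  {zero}  p≢q = ⊥-elim (p≢q refl)
  sgn-punchOut′-anti {p = zero}  {suc q} p≢q rewrite sgn-suc q = lemma (sgn q)
    where
    lemma : ∀ s → + 1 * s ≡ - ((- s) * + 1)
    lemma = solve-∀
  sgn-punchOut′-anti {p = suc p} {zero}  p≢q rewrite sgn-suc p = lemma (sgn p)
    where
    lemma : ∀ s → (- s) * + 1 ≡ - (+ 1 * s)
    lemma = solve-∀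
  sgn-punchOut′-anti {zero}  {suc zero} {suc zero} p≢q = ⊥-elim (p≢q refl)
  sgn-punchOut′-anti {suc m} {suc p} {suc q} p≢q = begin
    sgn (suc p) * sgn (suc (punchOut′ p q))
      ≡⟨ cong₂ _*_ (sgn-suc p) (sgn-suc (punchOut′ p q)) ⟩
    (- sgn p) * (- sgn (punchOut′ p q))
      ≡⟨ neg-squared (sgn p) _ ⟩
    sgn p * sgn (punchOut′ p q)
      ≡⟨ sgn-punchOut′-anti (p≢q ∘ cong suc) ⟩
    - (sgn q * sgn (punchOut′ q p))
      ≡⟨ cong -_ (neg-squared (sgn q) _) ⟨
    - ((- sgn q) * (- sgn (punchOut′ q p)))
      ≡⟨ cong -_ (cong₂ _*_ (sgn-suc q) (sgn-suc (punchOut′ q p))) ⟨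
    - (sgn (suc q) * sgn (suc (punchOut′ q p)))
      ∎
    where
    neg-squared : ∀ s t → (- s) * (- t) ≡ s * t
    neg-squared = solve-∀

  minor : ∀ {m} → Matrix (suc m) → Fin (suc m) → Matrix m
  minor M j r c = M (suc r) (punchIn j c)

  minor₂ : ∀ {m} → (Fin m → Fin (suc (suc m)) → ℤ) →
           Fin (suc (suc m)) → Fin (suc (suc m)) → Matrix m
  minor₂ R p q r c = R r (punchIn p (punchIn (punchOut′ p q) c))

  expand : ∀ {m} → Matrix (suc m) → (Fin (suc m) → ℤ) → ℤ
  expand {m} M v = sum (λ j → sgn j * (v j * det m (minor M j)))

  det-expand : ∀ {m} (M : Matrix (suc m)) → det (suc m) M ≡ expand M (M zero)
  det-expand {m} M = sumℤ≡sum (λ j → sgn j * (M zero j * det m (minor M j)))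

  det-cong : ∀ {m} {M N : Matrix m} → (∀ r c → M r c ≡ N r c) → det m M ≡ det m N
  det-cong {zero}          _   = refl
  det-cong {suc m} {M} {N} M≗N = begin
    det (suc m) M      ≡⟨ det-expand M ⟩
    expand M (M zero)  ≡⟨ sum-cong-≗ (λ j → cong₂ (λ x d → sgn j * (x * d)) (M≗N zero j)
                                       (det-cong (λ r c → M≗N (suc r) (punchIn j c)))) ⟩
    expand N (N zero)  ≡⟨ det-expand N ⟨
    det (suc m) N      ∎

  -- The terms of the Laplace expansion along two rows a and b, with column p for a and column q
  -- for b, on top of the remaining rows R.
  pairTerm : ∀ {m} (a b : Fin (suc (suc m)) → ℤ) → (Fin m → Fin (suc (suc m)) → ℤ) →
             Fin (suc (suc m)) → Fin (suc (suc m)) → ℤ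
  pairTerm {m} a b R p q =
    if does (p ≟ q) then 0ℤ
    else sgn p * sgn (punchOut′ p q) * (a p * b q) * det m (minor₂ R p q)

  det-pairTerms : ∀ {m} (M : Matrix (suc (suc m))) →
    det (suc (suc m)) M ≡ sum (λ p → sum (pairTerm (M zero) (M (suc zero)) (λ r → M (suc (suc r))) p))
  det-pairTerms {m} M = trans (det-expand M) (sum-cong-≗ expand-minor)
    where
    a b : Fin (suc (suc m)) → ℤ
    a = M zero
    b = M (suc zero)
    expand-minor : ∀ p → sgn p * (a p * det (suc m) (minor M p)) ≡
                         sum (pairTerm a b (λ r → M (suc (suc r))) p)
    expand-minor p = begin
      sgn p * (a p * det (suc m) (minor M p))
        ≡⟨ cong (λ d → sgn p * (a p * d)) (det-expand (minor M p)) ⟩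
      sgn p * (a p * sum (λ k → sgn k * (b (punchIn p k) * D k)))
        ≡⟨ cong (sgn p *_) (*-distribˡ-sum (a p) (λ k → sgn k * (b (punchIn p k) * D k))) ⟩
      sgn p * sum (λ k → a p * (sgn k * (b (punchIn p k) * D k)))
        ≡⟨ *-distribˡ-sum (sgn p) (λ k → a p * (sgn k * (b (punchIn p k) * D k))) ⟩
      sum (λ k → sgn p * (a p * (sgn k * (b (punchIn p k) * D k))))
        ≡⟨ sum-cong-≗ term ⟩
      sum (λ k → T (punchIn p k))
        ≡⟨ +-identityˡ (sum (λ k → T (punchIn p k))) ⟨
      0ℤ + sum (λ k → T (punchIn p k))
        ≡⟨ cong (_+ sum (λ k → T (punchIn p k))) T-diag ⟨
      T p + sum (λ k → T (punchIn p k))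
        ≡⟨ sum-remove T ⟨
      sum T
        ∎
      where
      D : Fin (suc m) → ℤ
      D k = det m (minor (minor M p) k)
      T : Fin (suc (suc m)) → ℤ
      T = pairTerm a b (λ r → M (suc (suc r))) p
      T-diag : T p ≡ 0ℤ
      T-diag rewrite dec-true (p ≟ p) refl = refl
      term : ∀ k → sgn p * (a p * (sgn k * (b (punchIn p k) * D k))) ≡ T (punchIn p k)
      term k rewrite dec-false (p ≟ punchIn p k) (punchInᵢ≢i p k ∘ sym) | punchOut′-punchIn p k =
        lemma (sgn p) (a p) (sgn k) (b (punchIn p k)) (D k)
        where
        lemma : ∀ s x t y d → s * (x * (t * (y * d))) ≡ s * t * (x * y) * d
        lemma = solve-∀

  pairTerm-swap : ∀ {m} a b (R : Fin m → Fin (suc (suc m)) → ℤ) p q →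
                  pairTerm b a R p q ≡ - pairTerm a b R q p
  pairTerm-swap {m} a b R p q with p ≟ q
  ... | yes refl rewrite dec-true (p ≟ p) refl = refl
  ... | no p≢q rewrite dec-false (q ≟ p) (p≢q ∘ sym) = begin
    sgn p * sgn (punchOut′ p q) * (b p * a q) * det m (minor₂ R p q)
      ≡⟨ cong₂ (λ s d → s * (b p * a q) * d) (sgn-punchOut′-anti p≢q)
           (det-cong (λ r c → cong (R r) (punchIn-punchOut′-comm p≢q c))) ⟩
    - (sgn q * sgn (punchOut′ q p)) * (b p * a q) * det m (minor₂ R q p)
      ≡⟨ lemma (sgn q * sgn (punchOut′ q p)) (b p) (a q) (det m (minor₂ R q p)) ⟩
    - (sgn q * sgn (punchOut′ q p) * (a q * b p) * det m (minor₂ R q p))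
      ∎
    where
    lemma : ∀ s x y d → - s * (x * y) * d ≡ - (s * (y * x) * d)
    lemma = solve-∀

  det-swap₀₁ : ∀ {m} (M : Matrix (suc (suc m))) →
               det (suc (suc m)) (M ∘ transpose zero (suc zero)) ≡ - det (suc (suc m)) M
  det-swap₀₁ {m} M = begin
    det (suc (suc m)) (M ∘ transpose zero (suc zero))
      ≡⟨ det-pairTerms (M ∘ transpose zero (suc zero)) ⟩
    sum (λ p → sum (λ q → pairTerm b a R p q))
      ≡⟨ sum-cong-≗ (λ p → sum-cong-≗ (pairTerm-swap a b R p)) ⟩
    sum (λ p → sum (λ q → - pairTerm a b R q p))
      ≡⟨ sum-cong-≗ (λ p → sum-neg (λ q → pairTerm a b R q p)) ⟩
    sum (λ p → - sum (λ q → pairTerm a b R q p))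
      ≡⟨ sum-neg (λ p → sum (λ q → pairTerm a b R q p)) ⟩
    - sum (λ p → sum (λ q → pairTerm a b R q p))
      ≡⟨ cong -_ (∑-comm (λ p q → pairTerm a b R q p)) ⟩
    - sum (λ q → sum (λ p → pairTerm a b R q p))
      ≡⟨ cong -_ (det-pairTerms M) ⟨
    - det (suc (suc m)) M
      ∎
    where
    a b : Fin (suc (suc m)) → ℤ
    a = M zero
    b = M (suc zero)
    R : Fin m → Fin (suc (suc m)) → ℤ
    R r = M (suc (suc r))

  det-swap-suc : ∀ {m} {i j : Fin m} → (∀ N → det m (N ∘ transpose i j) ≡ - det m N) →
                 ∀ M → det (suc m) (M ∘ transpose (suc i) (suc j)) ≡ - det (suc m) M
  det-swap-suc {m} {i} {j} det-swap M = begin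
    det (suc m) (M ∘ transpose (suc i) (suc j))
      ≡⟨ det-expand (M ∘ transpose (suc i) (suc j)) ⟩
    sum (λ k → sgn k * (M zero k * det m (minor (M ∘ transpose (suc i) (suc j)) k)))
      ≡⟨ sum-cong-≗ (λ k → cong (λ d → sgn k * (M zero k * d)) (swapped-minor k)) ⟩
    sum (λ k → sgn k * (M zero k * - det m (minor M k)))
      ≡⟨ sum-cong-≗ (λ k → lemma (sgn k) (M zero k) (det m (minor M k))) ⟩
    sum (λ k → - (sgn k * (M zero k * det m (minor M k))))
      ≡⟨ sum-neg (λ k → sgn k * (M zero k * det m (minor M k))) ⟩
    - expand M (M zero)
      ≡⟨ cong -_ (det-expand M) ⟨
    - det (suc m) M
      ∎
    where
    swapped-minor : ∀ k → det m (minor (M ∘ transpose (suc i) (suc j)) k) ≡ - det m (minor M k)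
    swapped-minor k = trans
      (det-cong (λ r c → cong (λ r′ → M r′ (punchIn k c)) (Perm.lift₀-transpose i j (suc r))))
      (det-swap (minor M k))
    lemma : ∀ s x d → s * (x * - d) ≡ - (s * (x * d))
    lemma = solve-∀

  transpose₀-conjugate : ∀ {m} (k : Fin m) r →
    transpose zero (suc (suc k)) r ≡
    transpose (suc zero) (suc (suc k)) (transpose zero (suc zero) (transpose (suc zero) (suc (suc k)) r))
  transpose₀-conjugate k zero = refl
  transpose₀-conjugate k (suc zero) rewrite dec-true (k ≟ k) refl = refl
  transpose₀-conjugate k (suc (suc r)) with r ≟ k
  ... | yes refl = refl
  ... | no r≢k rewrite dec-false (r ≟ k) r≢k = refl

  -- The implicit arguments are given explicitly: otherwise unification unfolds det at these
  -- concrete sizes, which is exponentially slow.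
  det-swap₀ : ∀ {m} (q : Fin (suc m)) (M : Matrix (suc (suc m))) →
              det (suc (suc m)) (M ∘ transpose zero (suc q)) ≡ - det (suc (suc m)) M
  det-swap₀ zero M = det-swap₀₁ M
  det-swap₀ {suc m} (suc k) M = begin
    det n (M ∘ t₀)
      ≡⟨ det-cong {n} {M ∘ t₀} {((M ∘ t₁) ∘ t₀₁) ∘ t₁}
           (λ r c → cong (λ r′ → M r′ c) (transpose₀-conjugate k r)) ⟩
    det n (((M ∘ t₁) ∘ t₀₁) ∘ t₁)
      ≡⟨ det-swap-suc {suc (suc m)} {zero} {suc k} (det-swap₀ k) ((M ∘ t₁) ∘ t₀₁) ⟩
    - det n ((M ∘ t₁) ∘ t₀₁)
      ≡⟨ cong -_ (det-swap₀₁ (M ∘ t₁)) ⟩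
    - - det n (M ∘ t₁)
      ≡⟨ neg-involutive (det n (M ∘ t₁)) ⟩
    det n (M ∘ t₁)
      ≡⟨ det-swap-suc {suc (suc m)} {zero} {suc k} (det-swap₀ k) M ⟩
    - det n M
      ∎
    where
    n = suc (suc (suc m))
    t₀ t₁ t₀₁ : Fin n → Fin n
    t₀ = transpose zero (suc (suc k))
    t₁ = transpose (suc zero) (suc (suc k))
    t₀₁ = transpose zero (suc zero)

  transpose-rows-≗ : ∀ {m n} (M : Fin m → Fin n → ℤ) {i j} → (∀ c → M i c ≡ M j c) →
                     ∀ k c → M (transpose i j k) c ≡ M k c
  transpose-rows-≗ M {i} {j} Mᵢ≗Mⱼ k c with k ≟ i
  ... | yes refl = sym (Mᵢ≗Mⱼ c)
  ... | no _ with k ≟ j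
  ...   | yes refl = Mᵢ≗Mⱼ c
  ...   | no _     = refl

  det-equal-rows : ∀ {m} (M : Matrix (suc m)) (r : Fin m) → (∀ c → M zero c ≡ M (suc r) c) →
                   det (suc m) M ≡ 0ℤ
  det-equal-rows {suc m} M r M₀≗Mᵣ = i≡-i⇒i≡0 (det n M) (begin
    det n M                             ≡⟨ det-cong (transpose-rows-≗ M M₀≗Mᵣ) ⟨
    det n (M ∘ transpose zero (suc r))  ≡⟨ det-swap₀ r M ⟩
    - det n M                           ∎)
    where
    n = suc (suc m)

  expand-linear : ∀ {m k} (M : Matrix (suc m)) (x : Fin k → ℤ) (w : Fin k → Fin (suc m) → ℤ) →
                  expand M (λ j → sum (λ r → x r * w r j)) ≡ sum (λ r → x r * expand M (w r))
  expand-linear {m} M x w = begin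
    sum (λ j → sgn j * (sum (λ r → x r * w r j) * D j))
      ≡⟨ sum-cong-≗ distribute ⟩
    sum (λ j → sum (λ r → x r * (sgn j * (w r j * D j))))
      ≡⟨ ∑-comm (λ j r → x r * (sgn j * (w r j * D j))) ⟩
    sum (λ r → sum (λ j → x r * (sgn j * (w r j * D j))))
      ≡⟨ sum-cong-≗ (λ r → *-distribˡ-sum (x r) (λ j → sgn j * (w r j * D j))) ⟨
    sum (λ r → x r * expand M (w r))
      ∎
    where
    D : Fin (suc m) → ℤ
    D j = det m (minor M j)
    distribute : ∀ j → sgn j * (sum (λ r → x r * w r j) * D j) ≡
                       sum (λ r → x r * (sgn j * (w r j * D j)))
    distribute j = begin
      sgn j * (sum (λ r → x r * w r j) * D j)
        ≡⟨ lemma₁ (sgn j) (sum (λ r → x r * w r j)) (D j) ⟩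
      sum (λ r → x r * w r j) * (sgn j * D j)
        ≡⟨ *-distribʳ-sum (sgn j * D j) (λ r → x r * w r j) ⟩
      sum (λ r → x r * w r j * (sgn j * D j))
        ≡⟨ sum-cong-≗ (λ r → lemma₂ (x r) (w r j) (sgn j) (D j)) ⟩
      sum (λ r → x r * (sgn j * (w r j * D j)))
        ∎
      where
      lemma₁ : ∀ s y d → s * (y * d) ≡ y * (s * d)
      lemma₁ = solve-∀
      lemma₂ : ∀ x y s d → x * y * (s * d) ≡ x * (s * (y * d))
      lemma₂ = solve-∀

  expand-other-row : ∀ {m} (M : Matrix (suc m)) (r : Fin m) → expand M (M (suc r)) ≡ 0ℤ
  expand-other-row {m} M r = trans (sym (det-expand M′)) (det-equal-rows M′ r (λ c → refl))
    where
    M′ : Matrix (suc m)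
    M′ zero    = M (suc r)
    M′ (suc i) = M (suc i)

  expand-≗0 : ∀ {m} (M : Matrix (suc m)) {v} → (∀ j → v j ≡ 0ℤ) → expand M v ≡ 0ℤ
  expand-≗0 {m} M {v} v≗0 = trans (sum-cong-≗ vanish) (sum-replicate-zero (suc m))
    where
    vanish : ∀ j → sgn j * (v j * det m (minor M j)) ≡ 0ℤ
    vanish j rewrite v≗0 j = *-zeroʳ (sgn j)

  x₀*det≡0 : ∀ {m} (M : Matrix (suc m)) (x : Fin (suc m) → ℤ) →
             (∀ c → sum (λ r → x r * M r c) ≡ 0ℤ) → x zero * det (suc m) M ≡ 0ℤ
  x₀*det≡0 {m} M x xM≗0 = begin
    x zero * det (suc m) M
      ≡⟨ cong (x zero *_) (det-expand M) ⟩
    x zero * expand M (M zero)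
      ≡⟨ +-identityʳ _ ⟨
    x zero * expand M (M zero) + 0ℤ
      ≡⟨ cong (λ s → x zero * expand M (M zero) + s) other-rows ⟨
    sum (λ r → x r * expand M (M r))
      ≡⟨ expand-linear M x M ⟨
    expand M (λ c → sum (λ r → x r * M r c))
      ≡⟨ expand-≗0 M xM≗0 ⟩
    0ℤ
      ∎
    where
    other-rows : sum (λ r → x (suc r) * expand M (M (suc r))) ≡ 0ℤ
    other-rows = trans
      (sum-cong-≗ (λ r → trans (cong (x (suc r) *_) (expand-other-row M r)) (*-zeroʳ (x (suc r)))))
      (sum-replicate-zero m)

  det≡0-of-dependent-rows₀ : ∀ {m} (M : Matrix (suc m)) (x : Fin (suc m) → ℤ) → x zero ≢ 0ℤ →
                             (∀ c → sum (λ r → x r * M r c) ≡ 0ℤ) → det (suc m) M ≡ 0ℤ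
  det≡0-of-dependent-rows₀ {m} M x x₀≢0 xM≗0 =
    fromInj₂ (⊥-elim ∘ x₀≢0) (i*j≡0⇒i≡0∨j≡0 (x zero) {det (suc m) M} (x₀*det≡0 M x xM≗0))

  det≡0-of-dependent-rows : ∀ {m} (M : Matrix m) (x : Fin m → ℤ) (i : Fin m) → x i ≢ 0ℤ →
                            (∀ c → sum (λ r → x r * M r c) ≡ 0ℤ) → det m M ≡ 0ℤ
  det≡0-of-dependent-rows M x zero = det≡0-of-dependent-rows₀ M x
  det≡0-of-dependent-rows {suc zero} M x (suc ())
  det≡0-of-dependent-rows {suc (suc m)} M x (suc q) xq≢0 xM≗0 = begin
    det n M          ≡⟨ neg-involutive (det n M) ⟨
    - - det n M      ≡⟨ cong -_ (det-swap₀ q M) ⟨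
    - det n (M ∘ t)  ≡⟨ cong -_ (det≡0-of-dependent-rows₀ (M ∘ t) (x ∘ t) xq≢0 swapped-dependency) ⟩
    0ℤ               ∎
    where
    n = suc (suc m)
    t : Fin n → Fin n
    t = transpose zero (suc q)
    swapped-dependency : ∀ c → sum (λ r → x (t r) * M (t r) c) ≡ 0ℤ
    swapped-dependency c =
      trans (sym (sum-permute (λ r → x r * M r c) (Perm.transpose zero (suc q)))) (xM≗0 c)

module CyclicGroup (n : ℕ) {{_ : NonZero n}} where
  open FinSum using (sum-reindex)
  open import Data.Nat.Base using (_+_; _∸_; _%_; >-nonZero⁻¹)
  open import Data.Nat.Properties using (+-comm; +-assoc; m∸n+n≡m; <⇒≤)
  open import Data.Nat.DivMod using (_mod_; %-distribˡ-+; m%n%n≡m%n; n%n≡0; m<n⇒m%n≡m; m%n<n)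
  open import Data.Fin.Base using (Fin; toℕ)
  open import Data.Fin.Properties using (toℕ-fromℕ<; toℕ-injective; toℕ<n)
  open import Data.Integer.Base using (ℤ)
  open import Data.Integer.Properties using (+-*-semiring)
  open import Algebra.Properties.Semiring.Sum +-*-semiring using (sum)
  open import Algebra.Bundles using (AbelianGroup)
  open import Algebra.Consequences.Propositional using (comm∧idˡ⇒id; comm∧invˡ⇒inv)
  open import Level using (0ℓ)
  open import Relation.Binary.PropositionalEquality
  open import Relation.Binary.PropositionalEquality.Algebra using (isMagma)
  open import Algebra.Structures {A = Fin n} _≡_ using (IsAbelianGroup)
  open ≡-Reasoning
  open Dihedral n using (_⊕_; ⊖_)

  𝟘 : Fin n
  𝟘 = 0 mod n

  private
    mod-cong : ∀ {a b} → a % n ≡ b % n → a mod n ≡ b mod n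
    mod-cong {a} {b} eq = toℕ-injective (begin
      toℕ (a mod n)  ≡⟨ toℕ-fromℕ< (m%n<n a n) ⟩
      a % n          ≡⟨ eq ⟩
      b % n          ≡⟨ toℕ-fromℕ< (m%n<n b n) ⟨
      toℕ (b mod n)  ∎)

    %-absorbˡ : ∀ a b → (a % n + b) % n ≡ (a + b) % n
    %-absorbˡ a b = begin
      (a % n + b) % n          ≡⟨ %-distribˡ-+ (a % n) b n ⟩
      (a % n % n + b % n) % n  ≡⟨ cong (λ x → (x + b % n) % n) (m%n%n≡m%n a n) ⟩
      (a % n + b % n) % n      ≡⟨ %-distribˡ-+ a b n ⟨
      (a + b) % n              ∎

    toℕ-⊕ : ∀ i j → toℕ (i ⊕ j) ≡ (toℕ i + toℕ j) % n
    toℕ-⊕ i j = toℕ-fromℕ< (m%n<n (toℕ i + toℕ j) n)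

  ⊕-comm : ∀ i j → i ⊕ j ≡ j ⊕ i
  ⊕-comm i j = cong (_mod n) (+-comm (toℕ i) (toℕ j))

  ⊕-assoc : ∀ i j k → (i ⊕ j) ⊕ k ≡ i ⊕ (j ⊕ k)
  ⊕-assoc i j k = mod-cong (begin
    (toℕ (i ⊕ j) + toℕ k) % n          ≡⟨ cong (λ x → (x + toℕ k) % n) (toℕ-⊕ i j) ⟩
    ((toℕ i + toℕ j) % n + toℕ k) % n  ≡⟨ %-absorbˡ (toℕ i + toℕ j) (toℕ k) ⟩
    (toℕ i + toℕ j + toℕ k) % n        ≡⟨ cong (_% n) (+-assoc (toℕ i) (toℕ j) (toℕ k)) ⟩
    (toℕ i + (toℕ j + toℕ k)) % n      ≡⟨ cong (_% n) (+-comm (toℕ i) (toℕ j + toℕ k)) ⟩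
    (toℕ j + toℕ k + toℕ i) % n        ≡⟨ %-absorbˡ (toℕ j + toℕ k) (toℕ i) ⟨
    ((toℕ j + toℕ k) % n + toℕ i) % n  ≡⟨ cong (λ x → (x + toℕ i) % n) (toℕ-⊕ j k) ⟨
    (toℕ (j ⊕ k) + toℕ i) % n          ≡⟨ cong (_% n) (+-comm (toℕ (j ⊕ k)) (toℕ i)) ⟩
    (toℕ i + toℕ (j ⊕ k)) % n          ∎)

  ⊕-identityˡ : ∀ j → 𝟘 ⊕ j ≡ j
  ⊕-identityˡ j = toℕ-injective (begin
    toℕ (𝟘 ⊕ j)                  ≡⟨ toℕ-⊕ 𝟘 j ⟩
    (toℕ (0 mod n) + toℕ j) % n  ≡⟨ cong (λ x → (x + toℕ j) % n) (toℕ-fromℕ< (m%n<n 0 n)) ⟩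
    (0 % n + toℕ j) % n          ≡⟨ %-absorbˡ 0 (toℕ j) ⟩
    toℕ j % n                    ≡⟨ m<n⇒m%n≡m (toℕ<n j) ⟩
    toℕ j                        ∎)

  ⊕-inverseˡ : ∀ j → (⊖ j) ⊕ j ≡ 𝟘
  ⊕-inverseˡ j = mod-cong (begin
    (toℕ (⊖ j) + toℕ j) % n
      ≡⟨ cong (λ x → (x + toℕ j) % n) (toℕ-fromℕ< (m%n<n (n ∸ toℕ j) n)) ⟩
    ((n ∸ toℕ j) % n + toℕ j) % n  ≡⟨ %-absorbˡ (n ∸ toℕ j) (toℕ j) ⟩
    (n ∸ toℕ j + toℕ j) % n        ≡⟨ cong (_% n) (m∸n+n≡m (<⇒≤ (toℕ<n j))) ⟩
    n % n                          ≡⟨ n%n≡0 n ⟩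
    0                              ≡⟨ m<n⇒m%n≡m (>-nonZero⁻¹ n) ⟨
    0 % n                          ∎)

  isAbelianGroup : IsAbelianGroup _⊕_ 𝟘 ⊖_
  isAbelianGroup = record
    { isGroup = record
      { isMonoid = record
        { isSemigroup = record { isMagma = isMagma _⊕_ ; assoc = ⊕-assoc }
        ; identity    = comm∧idˡ⇒id ⊕-comm ⊕-identityˡ
        }
      ; inverse = comm∧invˡ⇒inv ⊕-comm ⊕-inverseˡ
      ; ⁻¹-cong = cong ⊖_
      }
    ; comm = ⊕-comm
    }

  abelianGroup : AbelianGroup 0ℓ 0ℓ
  abelianGroup = record { isAbelianGroup = isAbelianGroup }

  open IsAbelianGroup isAbelianGroup public using (inverseʳ)
  open import Algebra.Properties.AbelianGroup abelianGroup public
    using (⁻¹-involutive; \\-leftDividesˡ; \\-leftDividesʳ)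

  sum-translate : ∀ (f : Fin n → ℤ) c → sum (λ j → f (c ⊕ j)) ≡ sum f
  sum-translate f c = sum-reindex f {c ⊕_} {(⊖ c) ⊕_} (\\-leftDividesˡ c) (\\-leftDividesʳ c)

  sum-negate : ∀ (f : Fin n → ℤ) → sum (λ j → f (⊖ j)) ≡ sum f
  sum-negate f = sum-reindex f {⊖_} {⊖_} ⁻¹-involutive ⁻¹-involutive

module CayleyGraph (n : ℕ) {{_ : NonZero n}} (H : Dihedral.Subset n) (1∉H : H (Dihedral.one n) ≡ false)
  where
  open FinSum using (sum-neg; sum-↑; 𝟙)
  open CyclicGroup n
  open Dihedral n
  open import Data.Bool.Base using (Bool; true; false; _xor_)
  open import Data.Product.Base using (_,_; proj₂)
  open import Data.Fin.Base using (_↑ˡ_; _↑ʳ_)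
  open import Data.Fin.Properties using (splitAt-↑ˡ; splitAt-↑ʳ)
  open import Data.Integer.Base using (ℤ; +_; -_; _+_; _*_; 0ℤ; -1ℤ)
  open import Data.Integer.Properties using (+-*-semiring; *-identityˡ; -1*i≡-i; +-inverseʳ)
  open import Algebra.Properties.Semiring.Sum +-*-semiring using (sum; sum-cong-≗)
  open import Relation.Nullary using (yes; no)
  open import Relation.Binary.PropositionalEquality
  open ≡-Reasoning

  ·-inverseʳ : ∀ u → u · (u ⁻¹) ≡ one
  ·-inverseʳ (i , false) = cong (_, false) (inverseʳ i)
  ·-inverseʳ (i , true)  = cong (_, false) (inverseʳ i)

  adj≡H : ∀ u v → adj H u v ≡ H (v · (u ⁻¹))
  adj≡H u v with u ≟D v
  ... | yes refl = sym (trans (cong H (·-inverseʳ u)) 1∉H)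
  ... | no _     = refl

  cosetCount : Bool → ℤ
  cosetCount s = sum (λ k → 𝟙 (H (k , s)))

  row-sum : ∀ u s → sum (λ j → 𝟙 (adj H u (j , s))) ≡ cosetCount (proj₂ u xor s)
  row-sum (i , t) s = trans (sum-cong-≗ (λ j → cong 𝟙 (adj≡H (i , t) (j , s)))) (translate t s)
    where
    translateʳ : ∀ s c → sum (λ j → 𝟙 (H (j ⊕ c , s))) ≡ cosetCount s
    translateʳ s c = trans (sum-cong-≗ (λ j → cong (λ k → 𝟙 (H (k , s))) (⊕-comm j c)))
                           (sum-translate (λ k → 𝟙 (H (k , s))) c)
    translate : ∀ t s → sum (λ j → 𝟙 (H ((j , s) · ((i , t) ⁻¹)))) ≡ cosetCount (t xor s)
    translate false false = translateʳ false (⊖ i)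
    translate false true  = translateʳ true (⊖ (⊖ i))
    translate true  false = translateʳ true i
    translate true  true  = translateʳ false (⊖ i)

  column-sum : ∀ v s → sum (λ j → 𝟙 (adj H (j , s) v)) ≡ cosetCount (s xor proj₂ v)
  column-sum (k , t) s = trans (sum-cong-≗ (λ j → cong 𝟙 (adj≡H (j , s) (k , t)))) (translate s t)
    where
    reflect : ∀ s → sum (λ j → 𝟙 (H (k ⊕ (⊖ j) , s))) ≡ cosetCount s
    reflect s = trans (sum-negate (λ j → 𝟙 (H (k ⊕ j , s)))) (sum-translate (λ j → 𝟙 (H (j , s))) k)
    translate : ∀ s t → sum (λ j → 𝟙 (H ((k , t) · ((j , s) ⁻¹)))) ≡ cosetCount (s xor t)
    translate false false = reflect false
    translate false true  = trans (sum-negate (λ j → 𝟙 (H (k ⊕ (⊖ j) , true)))) (reflect true)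
    translate true  false = sum-translate (λ j → 𝟙 (H (j , true))) k
    translate true  true  = reflect false

  enum-↑ˡ : ∀ i → enum (i ↑ˡ n) ≡ (i , false)
  enum-↑ˡ i rewrite splitAt-↑ˡ n i n = refl

  enum-↑ʳ : ∀ i → enum (n ↑ʳ i) ≡ (i , true)
  enum-↑ʳ i rewrite splitAt-↑ʳ n n i = refl

  χ : D → ℤ
  χ (_ , false) = + 1
  χ (_ , true)  = -1ℤ

  χ-kills-columns : cosetCount false ≡ cosetCount true →
                    ∀ c → sum (λ r → χ (enum r) * adjMatrix H r c) ≡ 0ℤ
  χ-kills-columns balanced c = begin
    sum (λ r → χ (enum r) * adjMatrix H r c)
      ≡⟨ sum-↑ n (λ r → χ (enum r) * adjMatrix H r c) ⟩
    sum (λ j → χ (enum (j ↑ˡ n)) * adjMatrix H (j ↑ˡ n) c) +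
    sum (λ j → χ (enum (n ↑ʳ j)) * adjMatrix H (n ↑ʳ j) c)
      ≡⟨ cong₂ _+_ (sum-cong-≗ from-V′) (sum-cong-≗ from-V″) ⟩
    sum (λ j → 𝟙 (adj H (j , false) v)) + sum (λ j → - 𝟙 (adj H (j , true) v))
      ≡⟨ cong (λ s → sum (λ j → 𝟙 (adj H (j , false) v)) + s)
              (sum-neg (λ j → 𝟙 (adj H (j , true) v))) ⟩
    sum (λ j → 𝟙 (adj H (j , false) v)) + - sum (λ j → 𝟙 (adj H (j , true) v))
      ≡⟨ cong₂ (λ a b → a + - b) (column-sum v false) (column-sum v true) ⟩
    cosetCount (false xor proj₂ v) + - cosetCount (true xor proj₂ v)
      ≡⟨ cong₂ (λ a b → a + - b) (constant (false xor proj₂ v)) (constant (true xor proj₂ v)) ⟩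
    cosetCount true + - cosetCount true
      ≡⟨ +-inverseʳ (cosetCount true) ⟩
    0ℤ
      ∎
    where
    v = enum c
    from-V′ : ∀ j → χ (enum (j ↑ˡ n)) * adjMatrix H (j ↑ˡ n) c ≡ 𝟙 (adj H (j , false) v)
    from-V′ j = trans (cong (λ u → χ u * 𝟙 (adj H u v)) (enum-↑ˡ j)) (*-identityˡ _)
    from-V″ : ∀ j → χ (enum (n ↑ʳ j)) * adjMatrix H (n ↑ʳ j) c ≡ - 𝟙 (adj H (j , true) v)
    from-V″ j = trans (cong (λ u → χ u * 𝟙 (adj H u v)) (enum-↑ʳ j)) (-1*i≡-i _)
    constant : ∀ s → cosetCount s ≡ cosetCount true
    constant false = balanced
    constant true  = refl

open Determinant using (det≡0-of-dependent-rows)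
open FinSum using (sum-𝟙; 𝟙)
open import Data.Nat.Base using (_+_; suc)
open import Data.Fin.Base using (Fin; zero)
open import Data.Bool.Base using (true)
open import Data.Product.Base using (_,_)
open import Data.Integer.Base using (+_)
open import Data.Integer.Properties using (+-*-semiring)
open import Algebra.Properties.Semiring.Sum +-*-semiring using (sum)
open import Function.Base using (_∘_)
open import Relation.Binary.PropositionalEquality using (cong; module ≡-Reasoning)
open ≡-Reasoning

corollary1p5 : (n : ℕ) {{_ : NonZero n}} (H : Dihedral.Subset n)
    → Dihedral.IsConnectingSet n H
    → (i : Fin n)
    → countFin (λ j → Dihedral.adj n H (i , false) (j , false))
      ≡ countFin (λ j → Dihedral.adj n H (i , false) (j , true))
    → Singular (n + n) (Dihedral.adjMatrix n H)
corollary1p5 (suc m) H connecting i balanced =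
  det≡0-of-dependent-rows (adjMatrix H) (χ ∘ enum) zero (λ ()) (χ-kills-columns cosets-balanced)
  where
  open Dihedral (suc m)
  open CayleyGraph (suc m) H (IsConnectingSet.no-one connecting)
  cosets-balanced : cosetCount false ≡ cosetCount true
  cosets-balanced = begin
    cosetCount false                                  ≡⟨ row-sum (i , false) false ⟨
    sum (λ j → 𝟙 (adj H (i , false) (j , false)))     ≡⟨ sum-𝟙 (λ j → adj H (i , false) (j , false)) ⟩
    + countFin (λ j → adj H (i , false) (j , false))  ≡⟨ cong +_ balanced ⟩
    + countFin (λ j → adj H (i , false) (j , true))   ≡⟨ sum-𝟙 (λ j → adj H (i , false) (j , true)) ⟨
    sum (λ j → 𝟙 (adj H (i , false) (j , true)))      ≡⟨ row-sum (i , false) true ⟩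
    cosetCount true                                   ∎
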